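{- Let $n,k$ be integers with $0<k<n/2$ and $n\neq 4k$, and suppose the generalized Petersen graph $G(n,k)$ is a core. If $G(n,k)$ is isomorphic to the underlying graph of $\mathrm{Cay}(S,C)$ for a semigroup $S$ and $C\subseteq S$, then $\mathrm{Cay}(S,C)$ has loops or $S$ is a group.
   Context: $G(n,k)$ ($0<k<n/2$) has vertices $u_0,\dots,u_{n-1},v_0,\dots,v_{n-1}$ and edges $u_iu_{i+1}$, $v_iv_{i+k}$, $u_iv_i$ (indices mod $n$). A graph is a core if all its endomorphisms are automorphisms. For a semigroup $S$ and $C\subseteq S$, $\mathrm{Cay}(S,C)$ is the directed multigraph with vertex set $S$ and one arc $(s,sc)$ for each $s\in S$, $c\in C$ (a loop when $sc=s$); its underlying graph is obtained by deleting loops, forgetting orientations and merging parallel edges. -}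

module Defs where

open import Data.Nat using (ℕ; _+_)
open import Data.Fin using (Fin; toℕ)
open import Data.Sum using (_⊎_; inj₁; inj₂)
open import Data.Product using (Σ; _×_; ∃; _,_)
open import Relation.Binary.PropositionalEquality using (_≡_)
open import Relation.Nullary using (¬_)
open import Function.Bundles using (_⤖_; Bijection)
open import Function.Definitions using (Bijective)
open import Algebra.Structures using (IsGroup)

record Graph : Set₁ where
  field
    V   : Set
    Adj : V → V → Set
open Graph public

-- Cyc n d i j : "j ≡ i + d (mod n)" for i, j < n and d < n.
Cyc : (n d : ℕ) → Fin n → Fin n → Set
Cyc n d i j = (toℕ j ≡ toℕ i + d) ⊎ (toℕ j + n ≡ toℕ i + d)

-- Generalized Petersen graph G(n,k): inj₁ i = u_i, inj₂ i = v_i.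
GPAdj : (n k : ℕ) → Fin n ⊎ Fin n → Fin n ⊎ Fin n → Set
GPAdj n k (inj₁ i) (inj₁ j) = Cyc n 1 i j ⊎ Cyc n 1 j i
GPAdj n k (inj₂ i) (inj₂ j) = Cyc n k i j ⊎ Cyc n k j i
GPAdj n k (inj₁ i) (inj₂ j) = i ≡ j
GPAdj n k (inj₂ i) (inj₁ j) = i ≡ j

GP : ℕ → ℕ → Graph
GP n k = record { V = Fin n ⊎ Fin n ; Adj = GPAdj n k }

IsHom : (G H : Graph) → (V G → V H) → Set
IsHom G H f = ∀ x y → Adj G x y → Adj H (f x) (f y)

IsAut : (G : Graph) → (V G → V G) → Set
IsAut G f = Bijective _≡_ _≡_ f × IsHom G G f × (∀ x y → Adj G (f x) (f y) → Adj G x y)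

IsCore : Graph → Set
IsCore G = ∀ (f : V G → V G) → IsHom G G f → IsAut G f

Iso : Graph → Graph → Set
Iso G H = Σ (V G ⤖ V H) λ f →
  ∀ x y → (Adj G x y → Adj H (Bijection.to f x) (Bijection.to f y))
        × (Adj H (Bijection.to f x) (Bijection.to f y) → Adj G x y)

-- Underlying simple graph of Cay(S,C): delete loops, forget orientation,
-- merge parallel edges.
CayUnderlying : (A : Set) → (A → A → A) → (A → Set) → Graph
CayUnderlying A _∙_ C = record
  { V = A
  ; Adj = λ s t → ¬ (s ≡ t) × ((Σ A λ c → C c × (s ∙ c ≡ t)) ⊎ (Σ A λ c → C c × (t ∙ c ≡ s))) }

HasLoop : (A : Set) → (A → A → A) → (A → Set) → Set
HasLoop A _∙_ C = Σ A λ s → Σ A λ c → C c × (s ∙ c ≡ s)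

IsGroupSG : (A : Set) → (A → A → A) → Set
IsGroupSG A _∙_ = Σ A λ e → Σ (A → A) λ inv → IsGroup _≡_ _∙_ e inv

module Submission where

-- Suppose no left translation t ∙_ of S collapses an edge of the Cayley graph (a collapse
-- would give the loop (t x) c = t x).  Then every t ∙_ is an endomorphism, hence, the
-- graph being a core, a bijection; so S is left cancellative with t S = S, every
-- idempotent is a left identity, and S is a group unless it has two distinct left
-- identities e ≠ f.  In that case, for generators c ≠ c′ outside {e, f}, the path
-- e — c — f — c′ — e is a 4-cycle, which G(n,k) does not have when k ≥ 2 and n ≠ 4k;
-- so C is a single generator c₀ up to loops.  But then every edge joins some x to x c₀,
-- which is impossible in a finite cubic graph (it would have only |S| edges, not 3|S|/2).
-- Finally G(n,1) is never a core: it folds onto its outer cycle.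

open import Defs
open import Algebra.Definitions using (LeftIdentity)
open import Algebra.Structures using (IsSemigroup)
open import Data.Empty using (⊥; ⊥-elim)
open import Data.Fin as Fin using (Fin; toℕ)
import Data.Fin.Properties as Fin
open import Data.Integer as ℤ using (ℤ; +_; -_; 0ℤ; -1ℤ; ∣_∣)
open import Data.Integer.Divisibility.Signed as ℤ∣ using (divides; ∣⇒∣ᵤ; ∣m∣n⇒∣m+n; ∣m⇒∣-m)
import Data.Integer.Properties as ℤ
open import Data.Integer.Tactic.RingSolver using (solve-∀)
open import Data.Nat as ℕ using (ℕ; zero; suc; _+_; _*_; _∸_; _<_; _≤_; z≤n; s≤s)
open import Data.Nat.Divisibility using (_∣_; _∤_; >⇒∤; ∣m+n∣m⇒∣n; ∣-refl)
import Data.Nat.Properties as ℕ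
import Data.Nat.Tactic.RingSolver as ℕ
open import Data.Product using (∃; ∃₂; _×_; _,_; proj₁; proj₂)
open import Data.Sign as Sign using (Sign)
open import Data.Sum using (_⊎_; inj₁; inj₂; [_,_]; [_,_]′)
open import Data.Sum.Properties using (inj₁-injective; inj₂-injective)
open import Function using (_∘_)
open import Function.Bundles using (Inverse; _↔_)
open import Function.Definitions using (Injective; Bijective)
open import Function.Properties.Bijection using (⤖⇒↔)
open import Function.Properties.Inverse using (↔⇒↣; ↔-sym; ↔-trans)
open import Relation.Binary.Definitions using (tri<; tri≈; tri>; DecidableEquality)
open import Relation.Binary.PropositionalEquality
  using (_≡_; _≢_; refl; sym; trans; cong; subst; subst₂; ≢-sym; module ≡-Reasoning)
open import Relation.Nullary using (¬_; Dec; yes; no; contradiction)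
open import Relation.Nullary.Decidable using (via-injection; map′; _×-dec_; _⊎-dec_; ¬?; decidable-stable)
open import Relation.Unary using (Decidable)

-- Finite types

injective⇒surjective : ∀ {m} {h : Fin m → Fin m} → Injective _≡_ _≡_ h → ∀ p → ∃ λ i → h i ≡ p
injective⇒surjective {suc m} {h} h-injective p with Fin.any? (λ i → h i Fin.≟ p)
... | yes hit = hit
... | no miss = contradiction (Fin.injective⇒≤ punched-injective) ℕ.1+n≰n
  where
  avoids : ∀ i → p ≢ h i
  avoids i p≡hi = miss (i , sym p≡hi)
  punched-injective : Injective _≡_ _≡_ (λ i → Fin.punchOut (avoids i))
  punched-injective = h-injective ∘ Fin.punchOut-injective (avoids _) (avoids _)

module Finite {A : Set} {m : ℕ} (enum : A ↔ Fin m) where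
  open Inverse enum

  _≟_ : DecidableEquality A
  _≟_ = via-injection (↔⇒↣ enum) Fin._≟_

  any? : ∀ {P : A → Set} → Decidable P → Dec (∃ P)
  any? {P} P? = map′ (λ (i , p) → from i , p) (λ (x , p) → to x , subst P (sym (strictlyInverseʳ x)) p)
    (Fin.any? (P? ∘ from))

  to-injective : Injective _≡_ _≡_ to
  to-injective {a} {b} ta≡tb = trans (sym (strictlyInverseʳ a)) (trans (cong from ta≡tb) (strictlyInverseʳ b))

  module _ (g : A → A) (surj : ∀ y → ∃ λ x → g x ≡ y) where
    private
      r : A → A
      r y = proj₁ (surj y)

      g∘r : ∀ y → g (r y) ≡ y
      g∘r y = proj₂ (surj y)

      r-injective : Injective _≡_ _≡_ r
      r-injective {a} {b} ra≡rb = trans (sym (g∘r a)) (trans (cong g ra≡rb) (g∘r b))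

      r-surjective : ∀ x → ∃ λ t → r t ≡ x
      r-surjective x = let i , to∘r∘from[i]≡x = injective⇒surjective to∘r∘from-injective (to x)
                       in from i , to-injective to∘r∘from[i]≡x
        where
        to∘r∘from-injective : Injective _≡_ _≡_ (to ∘ r ∘ from)
        to∘r∘from-injective {i} {j} eq =
          trans (sym (strictlyInverseˡ i)) (trans (cong to (r-injective (to-injective eq))) (strictlyInverseˡ j))

    surjective⇒injective : Injective _≡_ _≡_ g
    surjective⇒injective {x} {y} gx≡gy with t , refl ← r-surjective x | t′ , refl ← r-surjective y
      = cong r (trans (sym (g∘r t)) (trans gx≡gy (g∘r t′)))

-- Cubic graphs without 4-cycles

C₄-Free : Graph → Set
C₄-Free G = ∀ {a c b d} → Adj G a c → Adj G c b → Adj G b d → Adj G d a → a ≢ b → c ≢ d → ⊥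

record ThreeNeighbours (G : Graph) (x : V G) : Set where
  field
    y₁ y₂ y₃ : V G
    x~y₁ : Adj G x y₁
    x~y₂ : Adj G x y₂
    x~y₃ : Adj G x y₃
    y₁≢y₂ : y₁ ≢ y₂
    y₁≢y₃ : y₁ ≢ y₃
    y₂≢y₃ : y₂ ≢ y₃

Joins : {A : Set} → (A → A) → A → A → Set
Joins ρ a w = ρ a ≡ w ⊎ ρ w ≡ a

joins-distinct⇒preimage : ∀ {A : Set} {ρ : A → A} {a w w′} → w ≢ w′ → Joins ρ a w → Joins ρ a w′ →
  ρ w ≡ a ⊎ ρ w′ ≡ a
joins-distinct⇒preimage w≢w′ (inj₁ ρa≡w) (inj₁ ρa≡w′) = contradiction (trans (sym ρa≡w) ρa≡w′) w≢w′
joins-distinct⇒preimage _    (inj₂ ρw≡a) _            = inj₁ ρw≡a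
joins-distinct⇒preimage _    _            (inj₂ ρw′≡a) = inj₂ ρw′≡a

module _ (G : Graph) {m : ℕ} (enum : V G ↔ Fin m) (neighbours : ∀ x → ThreeNeighbours G x) where
  open Finite enum

  -- Two of any three neighbours of a vertex are ρ-preimages of it; so ρ is onto,
  -- hence one-to-one, and those two preimages collide.
  module _ {ρ : V G → V G} (joined : ∀ {a w} → Adj G a w → Joins ρ a w) where
    private
      ρ-surjective : ∀ a → ∃ λ w → ρ w ≡ a
      ρ-surjective a =
        [ (y₁ ,_) , (y₂ ,_) ]′ (joins-distinct⇒preimage {ρ = ρ} y₁≢y₂ (joined x~y₁) (joined x~y₂))
        where open ThreeNeighbours (neighbours a)

      collide : ∀ {x w w′} → w ≢ w′ → ρ w ≡ x → ρ w′ ≡ x → ⊥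
      collide w≢w′ ρw≡x ρw′≡x = w≢w′ (surjective⇒injective ρ ρ-surjective (trans ρw≡x (sym ρw′≡x)))

    ¬all-edges-joined : V G → ⊥
    ¬all-edges-joined x = two-of-three
      (joins-distinct⇒preimage {ρ = ρ} y₁≢y₂ (joined x~y₁) (joined x~y₂))
      (joins-distinct⇒preimage {ρ = ρ} y₁≢y₃ (joined x~y₁) (joined x~y₃))
      (joins-distinct⇒preimage {ρ = ρ} y₂≢y₃ (joined x~y₂) (joined x~y₃))
      where
      open ThreeNeighbours (neighbours x)
      two-of-three : ρ y₁ ≡ x ⊎ ρ y₂ ≡ x → ρ y₁ ≡ x ⊎ ρ y₃ ≡ x → ρ y₂ ≡ x ⊎ ρ y₃ ≡ x → ⊥
      two-of-three (inj₁ ρy₁≡x) _            (inj₁ ρy₂≡x) = collide y₁≢y₂ ρy₁≡x ρy₂≡x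
      two-of-three (inj₁ ρy₁≡x) _            (inj₂ ρy₃≡x) = collide y₁≢y₃ ρy₁≡x ρy₃≡x
      two-of-three (inj₂ ρy₂≡x) (inj₁ ρy₁≡x) _            = collide y₁≢y₂ ρy₁≡x ρy₂≡x
      two-of-three (inj₂ ρy₂≡x) (inj₂ ρy₃≡x) _            = collide y₂≢y₃ ρy₂≡x ρy₃≡x

  joins? : (ρ : V G → V G) → ∀ a w → Dec (Joins ρ a w)
  joins? ρ a w = (ρ a ≟ w) ⊎-dec (ρ w ≟ a)

  ∃-edge-not-joined : V G → (∀ a w → Dec (Adj G a w)) → (ρ : V G → V G) →
    ∃₂ λ a w → Adj G a w × ¬ Joins ρ a w
  ∃-edge-not-joined x adj? ρ with any? (λ a → any? (λ w → adj? a w ×-dec ¬? (joins? ρ a w)))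
  ... | yes (a , w , a~w , ¬joins) = a , w , a~w , ¬joins
  ... | no none = ⊥-elim (¬all-edges-joined {ρ}
        (λ {a} {w} a~w → decidable-stable (joins? ρ a w) (λ ¬joins → none (a , w , a~w , ¬joins))) x)

module IsoTransport {G H : Graph} (iso : Iso G H) where
  private
    open Inverse (⤖⇒↔ (proj₁ iso)) using ()
      renaming (to to φ; from to ψ; strictlyInverseˡ to φψ; strictlyInverseʳ to ψφ)

    preserve : ∀ {x y} → Adj G x y → Adj H (φ x) (φ y)
    preserve {x} {y} = proj₁ (proj₂ iso x y)

    reflect : ∀ {x y} → Adj H (φ x) (φ y) → Adj G x y
    reflect {x} {y} = proj₂ (proj₂ iso x y)

    ψ-preserve : ∀ {a b} → Adj H a b → Adj G (ψ a) (ψ b)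
    ψ-preserve {a} {b} a~b = reflect (subst₂ (Adj H) (sym (φψ a)) (sym (φψ b)) a~b)

    ψ-reflect : ∀ {a b} → Adj G (ψ a) (ψ b) → Adj H a b
    ψ-reflect {a} {b} ψa~ψb = subst₂ (Adj H) (φψ a) (φψ b) (preserve ψa~ψb)

    φ-injective : Injective _≡_ _≡_ φ
    φ-injective {x} {y} φx≡φy = trans (sym (ψφ x)) (trans (cong ψ φx≡φy) (ψφ y))

    ψ-injective : Injective _≡_ _≡_ ψ
    ψ-injective {a} {b} ψa≡ψb = trans (sym (φψ a)) (trans (cong φ ψa≡ψb) (φψ b))

  vertex : V G → V H
  vertex = φ

  enum : ∀ {m} → V G ↔ Fin m → V H ↔ Fin m
  enum = ↔-trans (↔-sym (⤖⇒↔ (proj₁ iso)))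

  adj? : (∀ x y → Dec (Adj G x y)) → ∀ a b → Dec (Adj H a b)
  adj? adjG? a b = map′ ψ-reflect ψ-preserve (adjG? (ψ a) (ψ b))

  c₄-free : C₄-Free G → C₄-Free H
  c₄-free c₄-freeG a~c c~b b~d d~a a≢b c≢d =
    c₄-freeG (ψ-preserve a~c) (ψ-preserve c~b) (ψ-preserve b~d) (ψ-preserve d~a)
      (a≢b ∘ ψ-injective) (c≢d ∘ ψ-injective)

  threeNeighbours : (∀ x → ThreeNeighbours G x) → ∀ a → ThreeNeighbours H a
  threeNeighbours neighbours a = record
    { y₁ = φ y₁ ; y₂ = φ y₂ ; y₃ = φ y₃
    ; x~y₁ = from-a (preserve x~y₁) ; x~y₂ = from-a (preserve x~y₂) ; x~y₃ = from-a (preserve x~y₃)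
    ; y₁≢y₂ = y₁≢y₂ ∘ φ-injective ; y₁≢y₃ = y₁≢y₃ ∘ φ-injective ; y₂≢y₃ = y₂≢y₃ ∘ φ-injective
    }
    where
    open ThreeNeighbours (neighbours (ψ a))
    from-a : ∀ {b} → Adj H (φ (ψ a)) b → Adj H a b
    from-a = subst (λ t → Adj H t _) (φψ a)

  isCore : IsCore G → IsCore H
  isCore core f f-hom = (f-injective , f-surjective) , f-hom , f-reflect
    where
    g : V G → V G
    g = ψ ∘ f ∘ φ
    g-hom : IsHom G G g
    g-hom x y x~y = ψ-preserve (f-hom (φ x) (φ y) (preserve x~y))
    g-aut : IsAut G g
    g-aut = core g g-hom
    g∘ψ : ∀ a → g (ψ a) ≡ ψ (f a)
    g∘ψ a = cong (ψ ∘ f) (φψ a)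
    f-injective : Injective _≡_ _≡_ f
    f-injective {a} {b} fa≡fb =
      ψ-injective (proj₁ (proj₁ g-aut) (trans (g∘ψ a) (trans (cong ψ fa≡fb) (sym (g∘ψ b)))))
    f-surjective : ∀ b → ∃ λ a → ∀ {z} → z ≡ a → f z ≡ b
    f-surjective b = let x , gx≡ψb = proj₂ (proj₁ g-aut) (ψ b) in
      φ x , λ { refl → trans (sym (φψ _)) (trans (cong φ (gx≡ψb refl)) (φψ b)) }
    f-reflect : ∀ a b → Adj H (f a) (f b) → Adj H a b
    f-reflect a b fa~fb = ψ-reflect (proj₂ (proj₂ g-aut) (ψ a) (ψ b)
      (subst₂ (Adj G) (sym (g∘ψ a)) (sym (g∘ψ b)) (ψ-preserve fa~fb)))

-- Semigroups whose left translations are bijective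

DistinctLeftIdentities : (A : Set) → (A → A → A) → Set
DistinctLeftIdentities A _∙_ = ∃₂ λ e f → e ≢ f × LeftIdentity _≡_ e _∙_ × LeftIdentity _≡_ f _∙_

module RightGroup {A : Set} {_∙_ : A → A → A} (isSemigroup : IsSemigroup _≡_ _∙_)
  (cancelˡ : ∀ t → Injective _≡_ _≡_ (t ∙_)) (divideˡ : ∀ t z → ∃ λ x → t ∙ x ≡ z) where
  open IsSemigroup isSemigroup using (assoc)

  rightUnit⇒idempotent : ∀ {t e} → t ∙ e ≡ t → e ∙ e ≡ e
  rightUnit⇒idempotent {t} {e} te≡t = cancelˡ t (trans (sym (assoc t e e)) (cong (_∙ e) te≡t))

  idempotent⇒leftIdentity : ∀ {e} → e ∙ e ≡ e → LeftIdentity _≡_ e _∙_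
  idempotent⇒leftIdentity {e} ee≡e x = cancelˡ e (trans (sym (assoc e e x)) (cong (_∙ x) ee≡e))

  rightIdentity⇒isGroup : ∀ {e} → e ∙ e ≡ e → (∀ x → x ∙ e ≡ x) → IsGroupSG A _∙_
  rightIdentity⇒isGroup {e} ee≡e identityʳ = e , inv , record
    { isMonoid = record { isSemigroup = isSemigroup ; identity = idempotent⇒leftIdentity ee≡e , identityʳ }
    ; inverse  = inverseˡ , inverseʳ
    ; ⁻¹-cong  = cong inv
    }
    where
    inv : A → A
    inv x = proj₁ (divideˡ x e)
    inverseʳ : ∀ x → x ∙ inv x ≡ e
    inverseʳ x = proj₂ (divideˡ x e)
    inverseˡ : ∀ x → inv x ∙ x ≡ e
    inverseˡ x = subst (λ t → inv x ∙ t ≡ e) (sym x≡inv[inv[x]]) (inverseʳ (inv x))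
      where
      open ≡-Reasoning
      x≡inv[inv[x]] : x ≡ inv (inv x)
      x≡inv[inv[x]] = begin
        x                          ≡⟨ identityʳ x ⟨
        x ∙ e                      ≡⟨ cong (x ∙_) (inverseʳ (inv x)) ⟨
        x ∙ (inv x ∙ inv (inv x))  ≡⟨ assoc x (inv x) (inv (inv x)) ⟨
        (x ∙ inv x) ∙ inv (inv x)  ≡⟨ cong (_∙ inv (inv x)) (inverseʳ x) ⟩
        e ∙ inv (inv x)            ≡⟨ idempotent⇒leftIdentity ee≡e (inv (inv x)) ⟩
        inv (inv x)                ∎

  isGroup⊎distinctLeftIdentities : ∀ {m} → A ↔ Fin m → A → IsGroupSG A _∙_ ⊎ DistinctLeftIdentities A _∙_
  isGroup⊎distinctLeftIdentities enum a = dichotomy (any? (λ x → ¬? ((x ∙ e) ≟ x)))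
    where
    open Finite enum
    e : A
    e = proj₁ (divideˡ a a)
    ee≡e : e ∙ e ≡ e
    ee≡e = rightUnit⇒idempotent (proj₂ (divideˡ a a))
    dichotomy : Dec (∃ λ x → x ∙ e ≢ x) → IsGroupSG A _∙_ ⊎ DistinctLeftIdentities A _∙_
    dichotomy (no ∄x) = inj₁ (rightIdentity⇒isGroup ee≡e λ x →
      decidable-stable ((x ∙ e) ≟ x) (λ xe≢x → ∄x (x , xe≢x)))
    dichotomy (yes (x , xe≢x)) =
      inj₂ (e , f , e≢f , idempotent⇒leftIdentity ee≡e , idempotent⇒leftIdentity ff≡f)
      where
      f : A
      f = proj₁ (divideˡ x x)
      ff≡f : f ∙ f ≡ f
      ff≡f = rightUnit⇒idempotent (proj₂ (divideˡ x x))
      e≢f : e ≢ f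
      e≢f e≡f = xe≢x (subst (λ t → x ∙ t ≡ x) (sym e≡f) (proj₂ (divideˡ x x)))

-- Cayley graphs of semigroups

module Cayley {A : Set} (_∙_ : A → A → A) (isSemigroup : IsSemigroup _≡_ _∙_) (C : A → Set) where
  open IsSemigroup isSemigroup using (assoc)

  Cay : Graph
  Cay = CayUnderlying A _∙_ C

  generator : ∀ {a w} → Adj Cay a w → ∃ λ c → C c × Joins (_∙ c) a w
  generator (_ , inj₁ (c , c∈C , ac≡w)) = c , c∈C , inj₁ ac≡w
  generator (_ , inj₂ (c , c∈C , wc≡a)) = c , c∈C , inj₂ wc≡a

  collapse⇒loop : ∀ {t x y} → Adj Cay x y → t ∙ x ≡ t ∙ y → HasLoop A _∙_ C
  collapse⇒loop {t} {x} {y} (_ , inj₁ (c , c∈C , xc≡y)) tx≡ty =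
    t ∙ x , c , c∈C , trans (assoc t x c) (trans (cong (t ∙_) xc≡y) (sym tx≡ty))
  collapse⇒loop {t} {x} {y} (_ , inj₂ (c , c∈C , yc≡x)) tx≡ty =
    t ∙ y , c , c∈C , trans (assoc t y c) (trans (cong (t ∙_) yc≡x) tx≡ty)

  translation-isHom : ∀ t → (∀ {x y} → Adj Cay x y → t ∙ x ≢ t ∙ y) → IsHom Cay Cay (t ∙_)
  translation-isHom t no-collapse x y x~y@(_ , inj₁ (c , c∈C , xc≡y)) =
    no-collapse x~y , inj₁ (c , c∈C , trans (assoc t x c) (cong (t ∙_) xc≡y))
  translation-isHom t no-collapse x y x~y@(_ , inj₂ (c , c∈C , yc≡x)) =
    no-collapse x~y , inj₂ (c , c∈C , trans (assoc t y c) (cong (t ∙_) yc≡x))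

  translation-bijective : IsCore Cay → (∀ {t x y} → Adj Cay x y → t ∙ x ≢ t ∙ y) →
    ∀ t → Bijective _≡_ _≡_ (t ∙_)
  translation-bijective core no-collapse t = proj₁ (core (t ∙_) (translation-isHom t no-collapse))

  distinct-generators⇒loop : DecidableEquality A → C₄-Free Cay → ∀ {e f c c′} →
    e ≢ f → LeftIdentity _≡_ e _∙_ → LeftIdentity _≡_ f _∙_ → C c → C c′ → c ≢ c′ → HasLoop A _∙_ C
  distinct-generators⇒loop _≟_ c₄-free {e} {f} {c} {c′} e≢f eˡ fˡ c∈C c′∈C c≢c′
    with c ≟ e | c ≟ f | c′ ≟ e | c′ ≟ f
  ... | yes refl | _        | _         | _         = c , c , c∈C , eˡ c
  ... | no _     | yes refl | _         | _         = c , c , c∈C , fˡ c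
  ... | no _     | no _     | yes refl  | _         = c′ , c′ , c′∈C , eˡ c′
  ... | no _     | no _     | no _      | yes refl  = c′ , c′ , c′∈C , fˡ c′
  ... | no c≢e   | no c≢f   | no c′≢e   | no c′≢f   = ⊥-elim (c₄-free
        (≢-sym c≢e , inj₁ (c , c∈C , eˡ c))
        (c≢f , inj₂ (c , c∈C , fˡ c))
        (≢-sym c′≢f , inj₁ (c′ , c′∈C , fˡ c′))
        (c′≢e , inj₂ (c′ , c′∈C , eˡ c′))
        e≢f c≢c′)

  module _ {m} (enum : A ↔ Fin m) (a : A) (adj? : ∀ x y → Dec (Adj Cay x y)) (c₄-free : C₄-Free Cay)
    (neighbours : ∀ x → ThreeNeighbours Cay x) where
    open Finite enum

    distinctLeftIdentities⇒loop : DistinctLeftIdentities A _∙_ → HasLoop A _∙_ C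
    distinctLeftIdentities⇒loop (e , f , e≢f , eˡ , fˡ)
      with c₀ , c₀∈C , _ ← generator (ThreeNeighbours.x~y₁ (neighbours a))
      with x , y , x~y , ¬joined ← ∃-edge-not-joined Cay enum neighbours a adj? (_∙ c₀)
      with c , c∈C , joined ← generator x~y
      = distinct-generators⇒loop _≟_ c₄-free e≢f eˡ fˡ c∈C c₀∈C (λ { refl → ¬joined joined })

    loop⊎isGroup : IsCore Cay → HasLoop A _∙_ C ⊎ IsGroupSG A _∙_
    loop⊎isGroup core with any? (λ t → any? (λ x → any? (λ y → adj? x y ×-dec ((t ∙ x) ≟ (t ∙ y)))))
    ... | yes (t , x , y , x~y , tx≡ty) = inj₁ (collapse⇒loop x~y tx≡ty)
    ... | no no-collapse = [ inj₂ , inj₁ ∘ distinctLeftIdentities⇒loop ]′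
          (RightGroup.isGroup⊎distinctLeftIdentities isSemigroup
            (proj₁ ∘ bijective) (λ t z → let x , tx≡z = proj₂ (bijective t) z in x , tx≡z refl) enum a)
      where
      bijective : ∀ t → Bijective _≡_ _≡_ (t ∙_)
      bijective = translation-bijective core (λ x~y tx≡ty → no-collapse (_ , _ , _ , x~y , tx≡ty))

-- Arithmetic modulo n

∣-<⇒≡0 : ∀ {n a} → n ∣ a → a < n → a ≡ 0
∣-<⇒≡0 {a = zero}  _   _   = refl
∣-<⇒≡0 {a = suc _} n∣a a<n = contradiction n∣a (>⇒∤ a<n)

∤-< : ∀ {n a} → 0 < a → a < n → n ∤ a
∤-< 0<a a<n n∣a = ℕ.<-irrefl (sym (∣-<⇒≡0 n∣a a<n)) 0<a

∤-<2n : ∀ {n a} → 0 < a → a < n + n → a ≢ n → n ∤ a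
∤-<2n {n} {a} 0<a a<2n a≢n n∣a with ℕ.<-cmp a n
... | tri< a<n _ _ = ∤-< 0<a a<n n∣a
... | tri≈ _ a≡n _ = a≢n a≡n
... | tri> _ _ n<a = ℕ.<⇒≱ n<a (ℕ.m∸n≡0⇒m≤n (∣-<⇒≡0 n∣a∸n a∸n<n))
  where
  a≡n+[a∸n] : a ≡ n + (a ∸ n)
  a≡n+[a∸n] = sym (ℕ.m+[n∸m]≡n (ℕ.<⇒≤ n<a))
  n∣a∸n : n ∣ a ∸ n
  n∣a∸n = ∣m+n∣m⇒∣n (subst (n ∣_) a≡n+[a∸n] n∣a) ∣-refl
  a∸n<n : a ∸ n < n
  a∸n<n = ℕ.+-cancelˡ-< n (a ∸ n) n (subst (_< n + n) a≡n+[a∸n] a<2n)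

module Congruence (n : ℕ) where

  -- y ≡ x + s (mod n); a record rather than a definition so that x, s and y can be inferred.
  infix 4 _⟶⟨_⟩_
  record _⟶⟨_⟩_ (x s y : ℤ) : Set where
    constructor mod
    field divides-difference : + n ℤ∣.∣ y ℤ.- (x ℤ.+ s)

  ⟦_⟧ : Fin n → ℤ
  ⟦ i ⟧ = + toℕ i

  ⟶-flip : ∀ {x s y} → x ⟶⟨ s ⟩ y → y ⟶⟨ - s ⟩ x
  ⟶-flip {x} {s} {y} (mod n∣) = mod (subst (+ n ℤ∣.∣_) (flip x s y) (∣m⇒∣-m n∣))
    where
    flip : ∀ x s y → - (y ℤ.- (x ℤ.+ s)) ≡ x ℤ.- (y ℤ.+ - s)
    flip = solve-∀

  ⟶-walk : ∀ {x s y t z} → x ⟶⟨ s ⟩ y → y ⟶⟨ t ⟩ z → x ⟶⟨ s ℤ.+ t ⟩ z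
  ⟶-walk {x} {s} {y} {t} {z} (mod n∣₁) (mod n∣₂) =
    mod (subst (+ n ℤ∣.∣_) (telescope x s y t z) (∣m∣n⇒∣m+n n∣₂ n∣₁))
    where
    telescope : ∀ x s y t z → (z ℤ.- (y ℤ.+ t)) ℤ.+ (y ℤ.- (x ℤ.+ s)) ≡ z ℤ.- (x ℤ.+ (s ℤ.+ t))
    telescope = solve-∀

  ⟶-closed : ∀ {x s} → x ⟶⟨ s ⟩ x → + n ℤ∣.∣ s
  ⟶-closed {x} {s} (mod n∣) = subst (+ n ℤ∣.∣_) (close x s) (∣m⇒∣-m n∣)
    where
    close : ∀ x s → - (x ℤ.- (x ℤ.+ s)) ≡ s
    close = solve-∀

  ⟶-cancel : ∀ {x s y} → + n ℤ∣.∣ s → x ⟶⟨ s ⟩ y → + n ℤ∣.∣ y ℤ.- x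
  ⟶-cancel {x} {s} {y} n∣s (mod n∣) = subst (+ n ℤ∣.∣_) (cancel x s y) (∣m∣n⇒∣m+n n∣ n∣s)
    where
    cancel : ∀ x s y → (y ℤ.- (x ℤ.+ s)) ℤ.+ s ≡ y ℤ.- x
    cancel = solve-∀

  ∣-difference⇒≡ : ∀ {i j : Fin n} → + n ℤ∣.∣ ⟦ j ⟧ ℤ.- ⟦ i ⟧ → i ≡ j
  ∣-difference⇒≡ {i} {j} n∣j-i = sym (Fin.toℕ-injective (ℤ.+-injective (ℤ.i-j≡0⇒i≡j _ _ j-i≡0)))
    where
    bound : ∣ ⟦ j ⟧ ℤ.- ⟦ i ⟧ ∣ < n
    bound = subst (_< n) (cong ∣_∣ (sym (ℤ.m-n≡m⊖n (toℕ j) (toℕ i))))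
      (ℕ.≤-<-trans (ℤ.∣m⊝n∣≤m⊔n (toℕ j) (toℕ i)) (ℕ.⊔-lub (Fin.toℕ<n j) (Fin.toℕ<n i)))
    j-i≡0 : ⟦ j ⟧ ℤ.- ⟦ i ⟧ ≡ 0ℤ
    j-i≡0 = ℤ.∣i∣≡0⇒i≡0 (∣-<⇒≡0 (∣⇒∣ᵤ n∣j-i) bound)

  cyc⇒⟶ : ∀ {d i j} → Cyc n d i j → ⟦ i ⟧ ⟶⟨ + d ⟩ ⟦ j ⟧
  cyc⇒⟶ {d} {i} {j} (inj₁ j≡i+d) = mod (divides 0ℤ (begin
    ⟦ j ⟧ ℤ.- (⟦ i ⟧ ℤ.+ + d)  ≡⟨ cong (λ t → ⟦ j ⟧ ℤ.- + t) (sym j≡i+d) ⟩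
    ⟦ j ⟧ ℤ.- ⟦ j ⟧            ≡⟨ ℤ.+-inverseʳ ⟦ j ⟧ ⟩
    0ℤ                          ∎))
    where open ≡-Reasoning
  cyc⇒⟶ {d} {i} {j} (inj₂ j+n≡i+d) = mod (divides -1ℤ (begin
    ⟦ j ⟧ ℤ.- (⟦ i ⟧ ℤ.+ + d)  ≡⟨ cong (λ t → ⟦ j ⟧ ℤ.- + t) (sym j+n≡i+d) ⟩
    ⟦ j ⟧ ℤ.- (⟦ j ⟧ ℤ.+ + n)  ≡⟨ wrap ⟦ j ⟧ (+ n) ⟩
    -1ℤ ℤ.* + n                 ∎))
    where
    open ≡-Reasoning
    wrap : ∀ x N → x ℤ.- (x ℤ.+ N) ≡ -1ℤ ℤ.* N
    wrap = solve-∀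

  ∣⇒∣ℕ : ∀ {x a} → + n ℤ∣.∣ x → x ≡ + a → n ∣ a
  ∣⇒∣ℕ n∣x refl = ∣⇒∣ᵤ n∣x

  ∣⇒∣ℕ⁻ : ∀ {x a} → + n ℤ∣.∣ x → x ≡ - + a → n ∣ a
  ∣⇒∣ℕ⁻ {a = a} n∣x refl = ∣⇒∣ℕ (∣m⇒∣-m n∣x) (ℤ.neg-involutive (+ a))

  signed : Sign → ℕ → ℤ
  signed Sign.+ d = + d
  signed Sign.- d = - + d

  CycEdge : ℕ → Fin n → Fin n → Set
  CycEdge d i j = Cyc n d i j ⊎ Cyc n d j i

  cycEdge⇒⟶ : ∀ {d i j} → CycEdge d i j → ∃ λ σ → ⟦ i ⟧ ⟶⟨ signed σ d ⟩ ⟦ j ⟧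
  cycEdge⇒⟶ {d} {i} {j} (inj₁ i→j) = Sign.+ , cyc⇒⟶ {d} {i} {j} i→j
  cycEdge⇒⟶ {d} {i} {j} (inj₂ j→i) = Sign.- , ⟶-flip (cyc⇒⟶ {d} {j} {i} j→i)

  -- The first two hypotheses forbid backtracking, which forces σ₁ = σ₂ = σ₃.
  square-signs : ∀ d σ₁ σ₂ σ₃ σ₄ → let s = λ σ → signed σ d in
    ¬ (+ n ℤ∣.∣ s σ₁ ℤ.+ s σ₂) → ¬ (+ n ℤ∣.∣ s σ₂ ℤ.+ s σ₃) →
    + n ℤ∣.∣ ((s σ₁ ℤ.+ s σ₂) ℤ.+ s σ₃) ℤ.+ s σ₄ →
    (n ∣ d + d) ⊎ (n ∣ (d + d) + (d + d))
  square-signs d Sign.+ Sign.- _ _ ∤12 _ _ = contradiction (divides 0ℤ (ℤ.+-inverseʳ (+ d))) ∤12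
  square-signs d Sign.- Sign.+ _ _ ∤12 _ _ = contradiction (divides 0ℤ (ℤ.+-inverseˡ (+ d))) ∤12
  square-signs d Sign.+ Sign.+ Sign.- _ _ ∤23 _ = contradiction (divides 0ℤ (ℤ.+-inverseʳ (+ d))) ∤23
  square-signs d Sign.- Sign.- Sign.+ _ _ ∤23 _ = contradiction (divides 0ℤ (ℤ.+-inverseˡ (+ d))) ∤23
  square-signs d Sign.+ Sign.+ Sign.+ Sign.+ _ _ n∣Σ = inj₂ (∣⇒∣ℕ n∣Σ (cong +_ (ℕ.+-assoc (d + d) d d)))
  square-signs d Sign.+ Sign.+ Sign.+ Sign.- _ _ n∣Σ = inj₁ (∣⇒∣ℕ n∣Σ (back (+ d)))
    where
    back : ∀ D → ((D ℤ.+ D) ℤ.+ D) ℤ.- D ≡ D ℤ.+ D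
    back = solve-∀
  square-signs d Sign.- Sign.- Sign.- Sign.- _ _ n∣Σ = inj₂ (∣⇒∣ℕ⁻ n∣Σ (fourfold (+ d)))
    where
    fourfold : ∀ D → ((- D ℤ.+ - D) ℤ.+ - D) ℤ.+ - D ≡ - ((D ℤ.+ D) ℤ.+ (D ℤ.+ D))
    fourfold = solve-∀
  square-signs d Sign.- Sign.- Sign.- Sign.+ _ _ n∣Σ = inj₁ (∣⇒∣ℕ⁻ n∣Σ (back (+ d)))
    where
    back : ∀ D → ((- D ℤ.+ - D) ℤ.+ - D) ℤ.+ D ≡ - (D ℤ.+ D)
    back = solve-∀

  spoke-signs : ∀ k σ₁ σ₂ → 1 ≤ k → + n ℤ∣.∣ signed σ₁ 1 ℤ.+ signed σ₂ k → (n ∣ 1 + k) ⊎ (n ∣ k ∸ 1)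
  spoke-signs k Sign.+ Sign.+ _ n∣Σ = inj₁ (∣⇒∣ᵤ n∣Σ)
  spoke-signs k Sign.- Sign.- _ n∣Σ = inj₁ (∣⇒∣ℕ⁻ n∣Σ (sym (ℤ.neg-distrib-+ (+ 1) (+ k))))
  spoke-signs k Sign.+ Sign.- 1≤k n∣Σ = inj₂ (∣⇒∣ℕ⁻ n∣Σ (trans (ℤ.m-n≡m⊖n 1 k) (ℤ.⊖-≤ 1≤k)))
  spoke-signs k Sign.- Sign.+ 1≤k n∣Σ = inj₂ (∣⇒∣ℕ n∣Σ (trans (ℤ.-m+n≡n⊖m 1 k) (ℤ.⊖-≥ 1≤k)))

  cycle-square-free : ∀ d → n ∤ d + d → n ∤ (d + d) + (d + d) → ∀ a c b e →
    CycEdge d a c → CycEdge d c b → CycEdge d b e → CycEdge d e a → a ≢ b → c ≢ e → ⊥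
  cycle-square-free d ∤2d ∤4d a c b e ac cb be ea a≢b c≢e
    with σ₁ , p ← cycEdge⇒⟶ {d} {a} {c} ac | σ₂ , q ← cycEdge⇒⟶ {d} {c} {b} cb
       | σ₃ , r ← cycEdge⇒⟶ {d} {b} {e} be | σ₄ , s ← cycEdge⇒⟶ {d} {e} {a} ea
    = [ ∤2d , ∤4d ] (square-signs d σ₁ σ₂ σ₃ σ₄
        (λ n∣s₁+s₂ → a≢b (∣-difference⇒≡ (⟶-cancel n∣s₁+s₂ (⟶-walk p q))))
        (λ n∣s₂+s₃ → c≢e (∣-difference⇒≡ (⟶-cancel n∣s₂+s₃ (⟶-walk q r))))
        (⟶-closed (⟶-walk (⟶-walk (⟶-walk p q) r) s)))

  spoke-square-free : ∀ k → 1 ≤ k → n ∤ 1 + k → n ∤ k ∸ 1 → ∀ a c → CycEdge 1 a c → CycEdge k c a → ⊥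
  spoke-square-free k 1≤k ∤k+1 ∤k-1 a c ac ca
    with σ₁ , p ← cycEdge⇒⟶ {1} {a} {c} ac | σ₂ , q ← cycEdge⇒⟶ {k} {c} {a} ca
    = [ ∤k+1 , ∤k-1 ] (spoke-signs k σ₁ σ₂ 1≤k (⟶-closed (⟶-walk p q)))

  cyc-unique : ∀ {d i j j′} → Cyc n d i j → Cyc n d i j′ → j ≡ j′
  cyc-unique {d} {i} {j} {j′} i→j i→j′ =
    ∣-difference⇒≡ (⟶-cancel (divides 0ℤ (ℤ.+-inverseˡ (+ d)))
      (⟶-walk (⟶-flip (cyc⇒⟶ {d} {i} {j} i→j)) (cyc⇒⟶ {d} {i} {j′} i→j′)))

  cyc-successor≢predecessor : ∀ {d i j j′} → n ∤ d + d → Cyc n d i j → Cyc n d j′ i → j ≢ j′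
  cyc-successor≢predecessor {d} {i} {j} ∤2d i→j j→i refl =
    ∤2d (∣⇒∣ᵤ (⟶-closed (⟶-walk (cyc⇒⟶ {d} {i} {j} i→j) (cyc⇒⟶ {d} {j} {i} j→i))))

  cyc-successor : ∀ {d} → d ≤ n → (i : Fin n) → ∃ λ j → Cyc n d i j
  cyc-successor {d} d≤n i with toℕ i + d ℕ.<? n
  ... | yes i+d<n = Fin.fromℕ< i+d<n , inj₁ (Fin.toℕ-fromℕ< i+d<n)
  ... | no i+d≮n = Fin.fromℕ< i+d∸n<n , inj₂ (begin
    toℕ (Fin.fromℕ< i+d∸n<n) + n  ≡⟨ cong (_+ n) (Fin.toℕ-fromℕ< i+d∸n<n) ⟩
    toℕ i + d ∸ n + n             ≡⟨ ℕ.m∸n+n≡m n≤i+d ⟩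
    toℕ i + d                     ∎)
    where
    open ≡-Reasoning
    n≤i+d : n ≤ toℕ i + d
    n≤i+d = ℕ.≮⇒≥ i+d≮n
    i+d∸n<n : toℕ i + d ∸ n < n
    i+d∸n<n = subst (toℕ i + d ∸ n <_) (ℕ.m+n∸n≡m n n)
      (ℕ.∸-monoˡ-< (ℕ.+-mono-<-≤ (Fin.toℕ<n i) d≤n) n≤i+d)

  cyc-predecessor : ∀ {d} → d ≤ n → (i : Fin n) → ∃ λ j → Cyc n d j i
  cyc-predecessor {d} d≤n i with d ℕ.≤? toℕ i
  ... | yes d≤i = Fin.fromℕ< i∸d<n , inj₁ (begin
    toℕ i                           ≡⟨ ℕ.m∸n+n≡m d≤i ⟨
    toℕ i ∸ d + d                   ≡⟨ cong (_+ d) (Fin.toℕ-fromℕ< i∸d<n) ⟨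
    toℕ (Fin.fromℕ< i∸d<n) + d      ∎)
    where
    open ≡-Reasoning
    i∸d<n : toℕ i ∸ d < n
    i∸d<n = ℕ.≤-<-trans (ℕ.m∸n≤m (toℕ i) d) (Fin.toℕ<n i)
  ... | no d≰i = Fin.fromℕ< i+n∸d<n , inj₂ (begin
    toℕ i + n                       ≡⟨ ℕ.m∸n+n≡m d≤i+n ⟨
    toℕ i + n ∸ d + d               ≡⟨ cong (_+ d) (Fin.toℕ-fromℕ< i+n∸d<n) ⟨
    toℕ (Fin.fromℕ< i+n∸d<n) + d    ∎)
    where
    open ≡-Reasoning
    d≤i+n : d ≤ toℕ i + n
    d≤i+n = ℕ.≤-trans d≤n (ℕ.m≤n+m n (toℕ i))
    i+n∸d<n : toℕ i + n ∸ d < n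
    i+n∸d<n = subst (toℕ i + n ∸ d <_) (ℕ.m+n∸m≡n d n)
      (ℕ.∸-monoˡ-< (ℕ.+-monoˡ-< n (ℕ.≰⇒> d≰i)) d≤i+n)

-- Generalized Petersen graphs

module GeneralizedPetersen (n k : ℕ) where
  open Congruence n

  cyc? : ∀ d i j → Dec (Cyc n d i j)
  cyc? d i j = (toℕ j ℕ.≟ toℕ i + d) ⊎-dec (toℕ j + n ℕ.≟ toℕ i + d)

  adj? : ∀ x y → Dec (Adj (GP n k) x y)
  adj? (inj₁ i) (inj₁ j) = cyc? 1 i j ⊎-dec cyc? 1 j i
  adj? (inj₂ i) (inj₂ j) = cyc? k i j ⊎-dec cyc? k j i
  adj? (inj₁ i) (inj₂ j) = i Fin.≟ j
  adj? (inj₂ i) (inj₁ j) = i Fin.≟ j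

  enum : V (GP n k) ↔ Fin (n + n)
  enum = ↔-sym Fin.+↔⊎

  cyc-neighbours : ∀ {d} → d ≤ n → n ∤ d + d → (i : Fin n) →
    ∃₂ λ j j′ → CycEdge d i j × CycEdge d i j′ × j ≢ j′
  cyc-neighbours d≤n ∤2d i =
    let j , i→j = cyc-successor d≤n i ; j′ , j′→i = cyc-predecessor d≤n i
    in j , j′ , inj₁ i→j , inj₂ j′→i , cyc-successor≢predecessor ∤2d i→j j′→i

  private
    k+k<n : 2 * k < n → k + k < n
    k+k<n = subst (_< n) (cong (λ t → k + t) (ℕ.+-identityʳ k))

    2k+2k≡4k : (k + k) + (k + k) ≡ 4 * k
    2k+2k≡4k = identity k
      where
      identity : ∀ k → (k + k) + (k + k) ≡ 4 * k
      identity = ℕ.solve-∀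

  threeNeighbours : 0 < k → 2 * k < n → ∀ x → ThreeNeighbours (GP n k) x
  threeNeighbours 0<k 2k<n (inj₁ i) =
    let j , j′ , i~j , i~j′ , j≢j′ = cyc-neighbours 1≤n (∤-< (s≤s z≤n) 2<n) i in
    record { y₁ = inj₁ j ; y₂ = inj₁ j′ ; y₃ = inj₂ i ; x~y₁ = i~j ; x~y₂ = i~j′ ; x~y₃ = refl
           ; y₁≢y₂ = j≢j′ ∘ inj₁-injective ; y₁≢y₃ = λ () ; y₂≢y₃ = λ () }
    where
    2<n : 2 < n
    2<n = ℕ.≤-<-trans (ℕ.+-mono-≤ 0<k 0<k) (k+k<n 2k<n)
    1≤n : 1 ≤ n
    1≤n = ℕ.≤-trans (s≤s z≤n) (ℕ.<⇒≤ 2<n)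
  threeNeighbours 0<k 2k<n (inj₂ i) =
    let j , j′ , i~j , i~j′ , j≢j′ = cyc-neighbours k≤n (∤-< (ℕ.+-mono-≤ 0<k z≤n) (k+k<n 2k<n)) i in
    record { y₁ = inj₂ j ; y₂ = inj₂ j′ ; y₃ = inj₁ i ; x~y₁ = i~j ; x~y₂ = i~j′ ; x~y₃ = refl
           ; y₁≢y₂ = j≢j′ ∘ inj₂-injective ; y₁≢y₃ = λ () ; y₂≢y₃ = λ () }
    where
    k≤n : k ≤ n
    k≤n = ℕ.<⇒≤ (ℕ.≤-<-trans (ℕ.m≤m+n k k) (k+k<n 2k<n))

  module _ (2≤k : 2 ≤ k) (2k<n : 2 * k < n) (n≢4k : n ≢ 4 * k) where
    private
      4<n : 4 < n
      4<n = ℕ.≤-<-trans (ℕ.+-mono-≤ 2≤k 2≤k) (k+k<n 2k<n)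

      1≤k : 1 ≤ k
      1≤k = ℕ.≤-trans (s≤s z≤n) 2≤k

      ∤2 : n ∤ 1 + 1
      ∤2 = ∤-< (s≤s z≤n) (ℕ.<-trans {2} {4} (s≤s (s≤s (s≤s z≤n))) 4<n)

      ∤4 : n ∤ (1 + 1) + (1 + 1)
      ∤4 = ∤-< (s≤s z≤n) 4<n

      ∤2k : n ∤ k + k
      ∤2k = ∤-< (ℕ.+-mono-≤ 1≤k z≤n) (k+k<n 2k<n)

      ∤4k : n ∤ (k + k) + (k + k)
      ∤4k = ∤-<2n (ℕ.+-mono-≤ (ℕ.+-mono-≤ 1≤k z≤n) z≤n) (ℕ.+-mono-< (k+k<n 2k<n) (k+k<n 2k<n))
        (λ 4k≡n → n≢4k (trans (sym 4k≡n) 2k+2k≡4k))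

      ∤1+k : n ∤ 1 + k
      ∤1+k = ∤-< (s≤s z≤n) (ℕ.≤-<-trans (ℕ.+-monoˡ-≤ k 1≤k) (k+k<n 2k<n))

      ∤k∸1 : n ∤ k ∸ 1
      ∤k∸1 = ∤-< (ℕ.∸-monoˡ-≤ 1 2≤k)
        (ℕ.≤-<-trans (ℕ.m∸n≤m k 1) (ℕ.≤-<-trans (ℕ.m≤m+n k k) (k+k<n 2k<n)))

      no-spoke-square : ∀ a c → CycEdge 1 a c → CycEdge k c a → ⊥
      no-spoke-square = spoke-square-free k 1≤k ∤1+k ∤k∸1

    c₄-free : C₄-Free (GP n k)
    c₄-free {inj₁ a} {inj₁ c} {inj₁ b} {inj₁ d} ac cb bd da a≢b c≢d =
      cycle-square-free 1 ∤2 ∤4 a c b d ac cb bd da (a≢b ∘ cong inj₁) (c≢d ∘ cong inj₁)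
    c₄-free {inj₂ a} {inj₂ c} {inj₂ b} {inj₂ d} ac cb bd da a≢b c≢d =
      cycle-square-free k ∤2k ∤4k a c b d ac cb bd da (a≢b ∘ cong inj₂) (c≢d ∘ cong inj₂)
    c₄-free {inj₁ a} {inj₁ c} {inj₂ _} {inj₂ _} ac refl bd refl _ _ = no-spoke-square a c ac bd
    c₄-free {inj₂ a} {inj₂ c} {inj₁ _} {inj₁ _} ac refl bd refl _ _ = no-spoke-square c a bd ac
    c₄-free {inj₁ a} {inj₂ _} {inj₂ b} {inj₁ _} refl cb refl da _ _ = no-spoke-square b a da cb
    c₄-free {inj₂ a} {inj₁ _} {inj₁ b} {inj₂ _} refl cb refl da _ _ = no-spoke-square a b cb da
    c₄-free {inj₁ _} {inj₂ _} {inj₁ _} {inj₁ _} refl refl _    _    a≢b _   = a≢b refl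
    c₄-free {inj₂ _} {inj₁ _} {inj₂ _} {inj₂ _} refl refl _    _    a≢b _   = a≢b refl
    c₄-free {inj₁ _} {inj₂ _} {inj₁ _} {inj₂ _} refl refl _    _    a≢b _   = a≢b refl
    c₄-free {inj₂ _} {inj₁ _} {inj₂ _} {inj₁ _} refl refl _    _    a≢b _   = a≢b refl
    c₄-free {inj₁ _} {inj₁ _} {inj₂ _} {inj₁ _} _    refl refl _    _   c≢d = c≢d refl
    c₄-free {inj₂ _} {inj₂ _} {inj₁ _} {inj₂ _} _    refl refl _    _   c≢d = c≢d refl
    c₄-free {inj₁ _} {inj₁ _} {inj₁ _} {inj₂ _} _    _    refl refl a≢b _   = a≢b refl
    c₄-free {inj₂ _} {inj₂ _} {inj₂ _} {inj₁ _} _    _    refl refl a≢b _   = a≢b refl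
    c₄-free {inj₁ _} {inj₂ _} {inj₂ _} {inj₂ _} refl _    _    refl _   c≢d = c≢d refl
    c₄-free {inj₂ _} {inj₁ _} {inj₁ _} {inj₁ _} refl _    _    refl _   c≢d = c≢d refl

prism-not-core : ∀ {n} → 0 < n → ¬ IsCore (GP n 1)
prism-not-core {n} 0<n core
  with proj₁ (proj₁ (core shift shift-isHom)) {inj₂ i₀} {inj₁ (succ i₀)} refl
  where
  open Congruence n
  i₀ : Fin n
  i₀ = Fin.fromℕ< 0<n
  succ : Fin n → Fin n
  succ i = proj₁ (cyc-successor 0<n i)
  i→succ : ∀ i → Cyc n 1 i (succ i)
  i→succ i = proj₂ (cyc-successor 0<n i)
  shift : V (GP n 1) → V (GP n 1)
  shift (inj₁ i) = inj₁ i
  shift (inj₂ i) = inj₁ (succ i)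
  shift-isHom : IsHom (GP n 1) (GP n 1) shift
  shift-isHom (inj₁ i) (inj₁ j) i~j = i~j
  shift-isHom (inj₁ i) (inj₂ j) refl = inj₁ (i→succ i)
  shift-isHom (inj₂ i) (inj₁ j) refl = inj₂ (i→succ i)
  shift-isHom (inj₂ i) (inj₂ j) (inj₁ i→j) =
    inj₁ (subst (Cyc n 1 (succ i) ∘ succ) (cyc-unique {1} {i} (i→succ i) i→j) (i→succ (succ i)))
  shift-isHom (inj₂ i) (inj₂ j) (inj₂ j→i) =
    inj₂ (subst (Cyc n 1 (succ j) ∘ succ) (cyc-unique {1} {j} (i→succ j) j→i) (i→succ (succ j)))
... | ()

corollary3p4 : (n k : ℕ) → 0 < k → 2 * k < n → ¬ (n ≡ 4 * k) →
    IsCore (GP n k) →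
    (A : Set) (_∙_ : A → A → A) → IsSemigroup _≡_ _∙_ → (C : A → Set) →
    Iso (GP n k) (CayUnderlying A _∙_ C) →
    HasLoop A _∙_ C ⊎ IsGroupSG A _∙_
corollary3p4 n 1 _ 2<n _ core _ _ _ _ _ = ⊥-elim (prism-not-core (ℕ.<-trans (s≤s z≤n) 2<n) core)
corollary3p4 n k@(suc (suc _)) 0<k 2k<n n≢4k core A _∙_ isSemigroup C iso =
  loop⊎isGroup (T.enum GP.enum) (T.vertex (inj₁ (Fin.fromℕ< 0<n))) (T.adj? GP.adj?)
    (T.c₄-free (GP.c₄-free (s≤s (s≤s z≤n)) 2k<n n≢4k)) (T.threeNeighbours (GP.threeNeighbours 0<k 2k<n))
    (T.isCore core)
  where
  module GP = GeneralizedPetersen n k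
  module T = IsoTransport {GP n k} {CayUnderlying A _∙_ C} iso
  open Cayley _∙_ isSemigroup C
  0<n : 0 < n
  0<n = ℕ.≤-<-trans z≤n 2k<n
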